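{- Let $A\subseteq N$ with $\mathrm{OPT}_A\neq\emptyset$ and let $\mathcal{P}\in\{\mathcal{P}_{\mathrm{even}}(A),\mathcal{P}_{\mathrm{odd}}(A)\}$. For each $P\in\mathcal{P}$, let $g_P$ be any element in $P$. Then $\{g_P\mid P\in\mathcal{P}\}\in\mathcal{I}$.
   Context: Let $M=(N,\mathcal{I})$ be a laminar matroid defined by a laminar family $\mathcal{L}\subseteq 2^N$ with bounds $b_L\geq 1$, i.e. $\mathcal{I}=\{I\subseteq N\mid |I\cap L|\leq b_L\ \forall L\in\mathcal{L}\}$, with $N\in\mathcal{L}$. Number the elements $N=\{f_1,\dots,f_n\}$ so that each $L\in\mathcal{L}$ consists of consecutively numbered elements. Weights are distinct. For $A\subseteq N$, $\mathrm{OPT}_A=\{f_{i_1},\dots,f_{i_p}\}$ with $i_1<\dots<i_p$ is the maximum weight independent set in $A$. Define $P_j=\{f_k\mid k\in\{i_{j-1},\dots,i_j\}\}\setminus A$ for $j\in\{1,\dots,p+1\}$, where $i_0=0$, $i_{p+1}=n$, and let $\mathcal{P}_{\mathrm{odd}}(A)=\{P_j\mid j\in[p+1], j\text{ odd}\}$, $\mathcal{P}_{\mathrm{even}}(A)=\{P_j\mid j\in[p+1], j\text{ even}\}$. -}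

module Defs where

open import Data.Nat using (ℕ; zero; suc; _+_; _≤_; _<_)
open import Data.Bool using (Bool; true; false)
open import Data.Fin using (Fin; toℕ)
open import Data.Fin.Subset using (Subset; _∈_; _∉_; _⊆_; _∩_; _∪_; ⁅_⁆; ⊥; ⊤; ∣_∣)
open import Data.Vec using (Vec; []; _∷_)
open import Data.List using (List; []; _∷_; map)
open import Data.List.Relation.Unary.All using (All)
open import Data.List.Relation.Unary.Any using (Any)
open import Data.Product using (_×_; _,_; proj₁; proj₂)
open import Data.Sum using (_⊎_)
open import Relation.Binary.PropositionalEquality using (_≡_)

-- Ground set N = {f_1,…,f_n} is Fin n; element f_k is the index k-1 (1-based position toℕ x + 1).
-- A laminar family with bounds: a list of pairs (L , b_L).
Family : ℕ → Set
Family n = List (Subset n × ℕ)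

Laminar : ∀ {n} → Family n → Set
Laminar {n} ℒ = All (λ L → All (λ L' →
  (proj₁ L ⊆ proj₁ L') ⊎ (proj₁ L' ⊆ proj₁ L) ⊎ (proj₁ L ∩ proj₁ L' ≡ ⊥)) ℒ) ℒ

Consecutive : ∀ {n} → Subset n → Set
Consecutive {n} L = ∀ (x y z : Fin n) → toℕ x ≤ toℕ y → toℕ y ≤ toℕ z → x ∈ L → z ∈ L → y ∈ L

WellFormedLaminar : ∀ {n} → Family n → Set
WellFormedLaminar {n} ℒ =
  Laminar ℒ × Any (λ L → proj₁ L ≡ ⊤) ℒ × All (λ L → 1 ≤ proj₂ L) ℒ × All (λ L → Consecutive (proj₁ L)) ℒ

Independent : ∀ {n} → Family n → Subset n → Set
Independent ℒ I = All (λ L → ∣ I ∩ proj₁ L ∣ ≤ proj₂ L) ℒ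

weight : ∀ {n} → (Fin n → ℕ) → Subset n → ℕ
weight {zero} w [] = 0
weight {suc n} w (true ∷ s) = w Fin.zero + weight (λ i → w (Fin.suc i)) s
  where import Data.Fin as Fin
weight {suc n} w (false ∷ s) = weight (λ i → w (Fin.suc i)) s
  where import Data.Fin as Fin

-- O is the maximum weight independent set contained in A (unique since weights are distinct)
IsOPT : ∀ {n} → Family n → (Fin n → ℕ) → Subset n → Subset n → Set
IsOPT ℒ w A O = O ⊆ A × Independent ℒ O ×
  (∀ I → I ⊆ A → Independent ℒ I → weight w I ≤ weight w O)

-- sorted list of 1-based positions of the elements of a subset: i_1 < … < i_p
positions : ∀ {n} → Subset n → List ℕ
positions [] = []
positions (true ∷ s) = 1 ∷ map suc (positions s)
positions (false ∷ s) = map suc (positions s)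

-- list of pairs (i_{j-1} , i_j) for j = 1 … p+1, given i_0 = prev, the i's, and i_{p+1} = last
gaps : ℕ → List ℕ → ℕ → List (ℕ × ℕ)
gaps prev [] last = (prev , last) ∷ []
gaps prev (i ∷ is) last = (prev , i) ∷ gaps i is last

-- membership in P_j = {f_k | i_{j-1} ≤ k ≤ i_j} \ A, where (a , b) = (i_{j-1} , i_j)
InPart : ∀ {n} → Subset n → ℕ × ℕ → Fin n → Set
InPart A (a , b) x = a ≤ suc (toℕ x) × suc (toℕ x) ≤ b × x ∉ A

mutual
  odds : ∀ {X : Set} → List X → List X
  odds [] = []
  odds (x ∷ xs) = x ∷ evens xs

  evens : ∀ {X : Set} → List X → List X
  evens [] = []
  evens (x ∷ xs) = odds xs

-- the families P_odd(A), P_even(A), each P_j represented by its pair (i_{j-1} , i_j)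
Pall : ∀ {n} → Subset n → Subset n → List (ℕ × ℕ)
Pall {n} A O = gaps 0 (positions O) n

Podd Peven : ∀ {n} → Subset n → Subset n → List (ℕ × ℕ)
Podd A O = odds (Pall A O)
Peven A O = evens (Pall A O)

toSubset : ∀ {n} → List (Fin n) → Subset n
toSubset [] = ⊥
toSubset (x ∷ xs) = ⁅ x ⁆ ∪ toSubset xs

-- Every member L of the laminar family is an interval of positions. The representatives come from
-- every other gap of OPT_A, so between two consecutive representatives lying in L there are two
-- elements of OPT_A, which lie in L as well. Hence if L contains c ≥ 2 representatives it contains
-- at least 2(c − 1) ≥ c elements of OPT_A, and c ≤ |OPT_A ∩ L| ≤ b_L; otherwise c ≤ 1 ≤ b_L.
module Submission where

open import Defs
open import Data.Nat using (ℕ; _≤_)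
open import Data.Fin using (Fin)
open import Data.Fin.Subset using (Subset; Nonempty)
open import Data.List using (List)
open import Data.List.Relation.Binary.Pointwise using (Pointwise)
open import Data.Product using (_×_)
open import Data.Sum using (_⊎_)
open import Function.Definitions using (Injective)
open import Relation.Binary.PropositionalEquality using (_≡_)

open import Data.Bool using (Bool; true; false)
open import Data.Nat using (zero; suc; _+_; _*_; _<_; _⊔_; z≤n; s≤s; z<s)
open import Data.Nat.Properties
open import Data.Fin as Fin using (toℕ; fromℕ<)
open import Data.Fin.Properties using (toℕ-fromℕ<; toℕ<n)
open import Data.Fin.Subset using (_∈_; _∩_; _∪_; ⁅_⁆; ∣_∣; ⊥)
open import Data.Fin.Subset.Properties using (∣⊥∣≡0; ∣p∣≤∣x∷p∣; ∩-zeroˡ; ∩-distribʳ-∪)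
open import Data.Vec using ([]; _∷_; lookup; here; there)
open import Data.Vec.Properties using ([]=⇒lookup)
open import Data.List using ([]; _∷_; map)
open import Data.List.Relation.Unary.All as All using (All; []; _∷_)
open import Data.List.Relation.Unary.All.Properties using (map⁺)
open import Data.List.Relation.Unary.Linked as Linked using (Linked; []; [-]; _∷_)
import Data.List.Relation.Unary.Linked.Properties as Linked
open import Data.List.Relation.Binary.Pointwise using ([]; _∷_)
open import Data.Product using (∃-syntax; _,_)
open import Data.Sum using (inj₁; inj₂)
open import Relation.Nullary using (yes; no)
open import Relation.Binary.PropositionalEquality using (refl; sym; trans; cong)

bit : Bool → ℕ
bit true  = 1
bit false = 0

countᵇ : {A : Set} → (A → Bool) → List A → ℕ
countᵇ p []       = 0
countᵇ p (x ∷ xs) = bit (p x) + countᵇ p xs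

count≡0⊎witness : {A : Set} {Q : A → Set} (p : A → Bool) {xs : List A} →
                  All Q xs → countᵇ p xs ≡ 0 ⊎ ∃[ x ] (p x ≡ true × Q x)
count≡0⊎witness p []                  = inj₁ refl
count≡0⊎witness p {x ∷ _} (qx ∷ qxs) with p x in px
... | true  = inj₂ (x , px , qx)
... | false = count≡0⊎witness p qxs

2*count-singleton≤2 : {A : Set} (p : A → Bool) (x : A) → 2 * countᵇ p (x ∷ []) ≤ 2
2*count-singleton≤2 p x with p x
... | true  = ≤-refl
... | false = z≤n

pos : ∀ {n} → Fin n → ℕ
pos x = suc (toℕ x)

-- Positions are 1-based, as in positions and InPart; position 0 holds no element.
memberAt : ∀ {n} → Subset n → ℕ → Bool
memberAt []      _             = false
memberAt (_ ∷ _) zero          = false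
memberAt (b ∷ _) (suc zero)    = b
memberAt (_ ∷ L) (suc (suc k)) = memberAt L (suc k)

memberAt-pos : ∀ {n} (L : Subset n) (x : Fin n) → memberAt L (pos x) ≡ lookup L x
memberAt-pos (_ ∷ _) Fin.zero    = refl
memberAt-pos (_ ∷ L) (Fin.suc x) = memberAt-pos L x

∈⇒memberAt : ∀ {n} {L : Subset n} {x : Fin n} → x ∈ L → memberAt L (pos x) ≡ true
∈⇒memberAt {L = L} {x} x∈L = trans (memberAt-pos L x) ([]=⇒lookup x∈L)

memberAt⇒∈ : ∀ {n} (L : Subset n) k → memberAt L k ≡ true → ∃[ x ] (x ∈ L × pos x ≡ k)
memberAt⇒∈ (true ∷ _) (suc zero)    refl = Fin.zero , here , refl
memberAt⇒∈ (_ ∷ L)    (suc (suc k)) eq with memberAt⇒∈ L (suc k) eq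
... | x , x∈L , refl = Fin.suc x , there x∈L , refl

Convex : (ℕ → Bool) → Set
Convex I = ∀ {x y z} → x ≤ y → y ≤ z → I x ≡ true → I z ≡ true → I y ≡ true

toℕ-onto : ∀ {n y} → y < n → ∃[ x ] (toℕ {n} x ≡ y)
toℕ-onto y<n = fromℕ< y<n , toℕ-fromℕ< y<n

Consecutive⇒Convex : ∀ {n} {L : Subset n} → Consecutive L → Convex (memberAt L)
Consecutive⇒Convex {L = L} consecutive {x} {y} {z} x≤y y≤z Lx Lz
  with memberAt⇒∈ L x Lx | memberAt⇒∈ L z Lz
Consecutive⇒Convex {L = L} consecutive {y = suc y} (s≤s x≤y) (s≤s y≤z) _ _
  | fx , fx∈L , refl | fz , fz∈L , refl
  with fy , refl ← toℕ-onto (≤-<-trans y≤z (toℕ<n fz))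
  = ∈⇒memberAt (consecutive fx fy fz x≤y y≤z fx∈L fz∈L)

zero-∷ : ∀ {xs} → Linked _≤_ xs → Linked _≤_ (0 ∷ xs)
zero-∷ []       = [-]
zero-∷ [-]      = z≤n ∷ [-]
zero-∷ (r ∷ rs) = z≤n ∷ r ∷ rs

positions-sorted : ∀ {n} (s : Subset n) → Linked _≤_ (positions s)
positions-sorted []          = []
positions-sorted (true ∷ s)  = Linked.map⁺ (Linked.map s≤s (zero-∷ (positions-sorted s)))
positions-sorted (false ∷ s) = Linked.map⁺ (Linked.map s≤s (positions-sorted s))

positions-positive : ∀ {n} (s : Subset n) → All (0 <_) (positions s)
positions-positive []          = []
positions-positive (true ∷ s)  = z<s ∷ map⁺ (All.universal (λ _ → z<s) (positions s))
positions-positive (false ∷ s) = map⁺ (All.universal (λ _ → z<s) (positions s))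

count-memberAt-∷ : ∀ {n} u (L : Subset n) ks → All (0 <_) ks →
                   countᵇ (memberAt (u ∷ L)) (map suc ks) ≡ countᵇ (memberAt L) ks
count-memberAt-∷ u L []            []       = refl
count-memberAt-∷ u L (suc k ∷ ks) (_ ∷ ps) = cong (bit (memberAt L (suc k)) +_) (count-memberAt-∷ u L ks ps)

count-positions-∷ : ∀ {n} u (L O : Subset n) →
                    countᵇ (memberAt (u ∷ L)) (map suc (positions O)) ≡ countᵇ (memberAt L) (positions O)
count-positions-∷ u L O = count-memberAt-∷ u L (positions O) (positions-positive O)

∣∩∣≡count-positions : ∀ {n} (O L : Subset n) → ∣ O ∩ L ∣ ≡ countᵇ (memberAt L) (positions O)
∣∩∣≡count-positions []          []          = refl
∣∩∣≡count-positions (true ∷ O)  (true ∷ L)  =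
  cong suc (trans (∣∩∣≡count-positions O L) (sym (count-positions-∷ true L O)))
∣∩∣≡count-positions (true ∷ O)  (false ∷ L) =
  trans (∣∩∣≡count-positions O L) (sym (count-positions-∷ false L O))
∣∩∣≡count-positions (false ∷ O) (u ∷ L)     =
  trans (∣∩∣≡count-positions O L) (sym (count-positions-∷ u L O))

∣p∪q∣≤∣p∣+∣q∣ : ∀ {n} (p q : Subset n) → ∣ p ∪ q ∣ ≤ ∣ p ∣ + ∣ q ∣
∣p∪q∣≤∣p∣+∣q∣ []          []          = z≤n
∣p∪q∣≤∣p∣+∣q∣ (true ∷ p)  (b ∷ q)     =
  s≤s (≤-trans (∣p∪q∣≤∣p∣+∣q∣ p q) (+-monoʳ-≤ ∣ p ∣ (∣p∣≤∣x∷p∣ b q)))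
∣p∪q∣≤∣p∣+∣q∣ (false ∷ p) (true ∷ q)  =
  ≤-trans (s≤s (∣p∪q∣≤∣p∣+∣q∣ p q)) (≤-reflexive (sym (+-suc ∣ p ∣ ∣ q ∣)))
∣p∪q∣≤∣p∣+∣q∣ (false ∷ p) (false ∷ q) = ∣p∪q∣≤∣p∣+∣q∣ p q

∣⊥∩p∣≡0 : ∀ {n} (p : Subset n) → ∣ ⊥ ∩ p ∣ ≡ 0
∣⊥∩p∣≡0 {n} p = trans (cong ∣_∣ (∩-zeroˡ p)) (∣⊥∣≡0 n)

∣⁅x⁆∩p∣≡bit : ∀ {n} (x : Fin n) (p : Subset n) → ∣ ⁅ x ⁆ ∩ p ∣ ≡ bit (lookup p x)
∣⁅x⁆∩p∣≡bit Fin.zero    (true ∷ p)  = cong suc (∣⊥∩p∣≡0 p)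
∣⁅x⁆∩p∣≡bit Fin.zero    (false ∷ p) = ∣⊥∩p∣≡0 p
∣⁅x⁆∩p∣≡bit (Fin.suc x) (_ ∷ p)     = ∣⁅x⁆∩p∣≡bit x p

∣toSubset∩∣≤count : ∀ {n} (g : List (Fin n)) (L : Subset n) →
                    ∣ toSubset g ∩ L ∣ ≤ countᵇ (memberAt L) (map pos g)
∣toSubset∩∣≤count []      L = ≤-reflexive (∣⊥∩p∣≡0 L)
∣toSubset∩∣≤count (x ∷ g) L = begin
  ∣ (⁅ x ⁆ ∪ toSubset g) ∩ L ∣           ≡⟨ cong ∣_∣ (∩-distribʳ-∪ L ⁅ x ⁆ (toSubset g)) ⟩
  ∣ (⁅ x ⁆ ∩ L) ∪ (toSubset g ∩ L) ∣     ≤⟨ ∣p∪q∣≤∣p∣+∣q∣ (⁅ x ⁆ ∩ L) (toSubset g ∩ L) ⟩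
  ∣ ⁅ x ⁆ ∩ L ∣ + ∣ toSubset g ∩ L ∣     ≤⟨ +-monoʳ-≤ ∣ ⁅ x ⁆ ∩ L ∣ (∣toSubset∩∣≤count g L) ⟩
  ∣ ⁅ x ⁆ ∩ L ∣ + countᵇ (memberAt L) (map pos g)
    ≡⟨ cong (_+ countᵇ (memberAt L) (map pos g))
            (trans (∣⁅x⁆∩p∣≡bit x L) (cong bit (sym (memberAt-pos L x)))) ⟩
  countᵇ (memberAt L) (map pos (x ∷ g))  ∎
  where open ≤-Reasoning

Between : ℕ × ℕ → ℕ → Set
Between (a , b) q = a ≤ q × q ≤ b

odd-gap-reps-≥ : ∀ {prev is last qs} → Linked _≤_ (prev ∷ is) →
                 Pointwise Between (odds (gaps prev is last)) qs → All (prev ≤_) qs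
odd-gap-reps-≥ {is = []}        _ ((p≤q , _) ∷ []) = p≤q ∷ []
odd-gap-reps-≥ {is = _ ∷ []}    _ ((p≤q , _) ∷ []) = p≤q ∷ []
odd-gap-reps-≥ {is = _ ∷ _ ∷ _} (p≤i₁ ∷ i₁≤i₂ ∷ sorted) ((p≤q , _) ∷ reps) =
  p≤q ∷ All.map (≤-trans (≤-trans p≤i₁ i₁≤i₂)) (odd-gap-reps-≥ sorted reps)

module _ {I : ℕ → Bool} (convex : Convex I) where

  count-odd-gap-reps : ∀ {prev is last qs} → Linked _≤_ (prev ∷ is) →
                       Pointwise Between (odds (gaps prev is last)) qs →
                       2 * countᵇ I qs ≤ countᵇ I is + 2
  count-odd-gap-reps {is = []}     {qs = q ∷ []} _ (_ ∷ []) = 2*count-singleton≤2 I q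
  count-odd-gap-reps {is = _ ∷ []} {qs = q ∷ []} _ (_ ∷ []) =
    ≤-trans (2*count-singleton≤2 I q) (m≤n+m 2 _)
  count-odd-gap-reps {is = i₁ ∷ i₂ ∷ rest} {qs = q ∷ qs} (_ ∷ i₁≤i₂ ∷ sorted) ((_ , q≤i₁) ∷ reps)
    with IH ← count-odd-gap-reps sorted reps | I q in Iq
  ... | false = ≤-trans IH (+-monoˡ-≤ 2 (≤-trans (m≤n+m _ (bit (I i₂))) (m≤n+m _ (bit (I i₁)))))
  ... | true with count≡0⊎witness I (odd-gap-reps-≥ sorted reps)
  ...   | inj₁ none rewrite none = m≤n+m 2 _
  -- A later representative q′ in L forces i₁, i₂ ∈ L, as q ≤ i₁ ≤ i₂ ≤ q′.
  ...   | inj₂ (q′ , Iq′ , i₂≤q′)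
    rewrite convex q≤i₁ (≤-trans i₁≤i₂ i₂≤q′) Iq Iq′
          | convex (≤-trans q≤i₁ i₁≤i₂) i₂≤q′ Iq Iq′ = begin
      2 * suc (countᵇ I qs)        ≡⟨ *-suc 2 (countᵇ I qs) ⟩
      2 + 2 * countᵇ I qs          ≤⟨ +-monoʳ-≤ 2 IH ⟩
      2 + (countᵇ I rest + 2)      ∎
    where open ≤-Reasoning

  count-even-gap-reps : ∀ {prev is last qs} → Linked _≤_ (prev ∷ is) →
                        Pointwise Between (evens (gaps prev is last)) qs →
                        2 * countᵇ I qs ≤ countᵇ I is + 2
  count-even-gap-reps {is = []}    _      []   = z≤n
  count-even-gap-reps {is = i ∷ _} sorted reps =
    ≤-trans (count-odd-gap-reps (Linked.tail sorted) reps) (+-monoˡ-≤ 2 (m≤n+m _ (bit (I i))))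

reps-between : ∀ {n} {A : Subset n} {𝒫 g} →
               Pointwise (λ P x → InPart A P x) 𝒫 g → Pointwise Between 𝒫 (map pos g)
reps-between []                = []
reps-between ((a , b , _) ∷ rs) = (a , b) ∷ reps-between rs

2*∣reps∩L∣≤∣O∩L∣+2 : ∀ {n} {A O L : Subset n} {𝒫 : List (ℕ × ℕ)} {g : List (Fin n)} →
                     Consecutive L → (𝒫 ≡ Peven A O ⊎ 𝒫 ≡ Podd A O) →
                     Pointwise (λ P x → InPart A P x) 𝒫 g →
                     2 * ∣ toSubset g ∩ L ∣ ≤ ∣ O ∩ L ∣ + 2
2*∣reps∩L∣≤∣O∩L∣+2 {A = A} {O} {L} {𝒫} {g} consecutive parity reps = begin
  2 * ∣ toSubset g ∩ L ∣                 ≤⟨ *-monoʳ-≤ 2 (∣toSubset∩∣≤count g L) ⟩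
  2 * countᵇ (memberAt L) (map pos g)    ≤⟨ by-parity parity ⟩
  countᵇ (memberAt L) (positions O) + 2  ≡⟨ cong (_+ 2) (sym (∣∩∣≡count-positions O L)) ⟩
  ∣ O ∩ L ∣ + 2                          ∎
  where
  open ≤-Reasoning
  convex : Convex (memberAt L)
  convex = Consecutive⇒Convex consecutive
  sorted : Linked _≤_ (0 ∷ positions O)
  sorted = zero-∷ (positions-sorted O)
  by-parity : 𝒫 ≡ Peven A O ⊎ 𝒫 ≡ Podd A O → 2 * countᵇ (memberAt L) (map pos g) ≤ countᵇ (memberAt L) (positions O) + 2
  by-parity (inj₁ refl) = count-even-gap-reps convex sorted (reps-between reps)
  by-parity (inj₂ refl) = count-odd-gap-reps  convex sorted (reps-between reps)

2*c≤m+2⇒c≤m⊔1 : ∀ {c} m → 2 * c ≤ m + 2 → c ≤ m ⊔ 1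
2*c≤m+2⇒c≤m⊔1 {c} m 2c≤m+2 with c ≤? 1
... | yes c≤1 = ≤-trans c≤1 (m≤n⊔m m 1)
... | no  c≰1 = ≤-trans (+-cancelʳ-≤ 2 c m c+2≤m+2) (m≤m⊔n m 1)
  where
  open ≤-Reasoning
  c+2≤m+2 : c + 2 ≤ m + 2
  c+2≤m+2 = begin
    c + 2        ≤⟨ +-monoʳ-≤ c (≰⇒> c≰1) ⟩
    c + c        ≡⟨ cong (c +_) (sym (+-identityʳ c)) ⟩
    2 * c        ≤⟨ 2c≤m+2 ⟩
    m + 2        ∎

mainTheorem3 : (n : ℕ) (ℒ : Family n) → WellFormedLaminar ℒ →
    (w : Fin n → ℕ) → Injective _≡_ _≡_ w → (∀ x → 1 ≤ w x) →
    (A O : Subset n) → IsOPT ℒ w A O → Nonempty O →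
    (𝒫 : List (ℕ × ℕ)) → (𝒫 ≡ Peven A O ⊎ 𝒫 ≡ Podd A O) →
    (g : List (Fin n)) → Pointwise (λ P x → InPart A P x) 𝒫 g →
    Independent ℒ (toSubset g)
mainTheorem3 n _ (_ , _ , bounds-positive , consecutive) _ _ _ _ O (_ , O-independent , _) _ _ parity g reps =
  All.zipWith member-bound (bounds-positive , All.zip (consecutive , O-independent))
  where
  member-bound : ∀ {Lb : Subset n × ℕ} → let (L , b) = Lb in
                 1 ≤ b × Consecutive L × ∣ O ∩ L ∣ ≤ b → ∣ toSubset g ∩ L ∣ ≤ b
  member-bound {L , b} (1≤b , consecutive-L , ∣O∩L∣≤b) =
    ≤-trans (2*c≤m+2⇒c≤m⊔1 ∣ O ∩ L ∣ (2*∣reps∩L∣≤∣O∩L∣+2 {O = O} consecutive-L parity reps)) (⊔-lub ∣O∩L∣≤b 1≤b)
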